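{- For any $n\geq 2$, the Greene–Kleitman symmetric chain decomposition of $Q_n$ can be extended to a Hamilton cycle of $Q_n$; that is, there is a Hamilton cycle of $Q_n$ that contains every edge of every chain of this decomposition.
   Context: $Q_n$ is the graph on all $\{0,1\}$-strings of length $n$, two strings adjacent if they differ in exactly one bit; level $k$ is the set of strings with exactly $k$ ones. A symmetric chain is a path $(x_k,x_{k+1},\ldots,x_{n-k})$ in $Q_n$ with $x_i$ on level $i$; a symmetric chain decomposition is a partition of the vertex set of $Q_n$ into symmetric chains. The Greene–Kleitman decomposition: interpret every 0 of a vertex $x$ as an opening bracket and every 1 as a closing bracket, and match brackets in the usual way (closest pairs). The chain containing $x$ is obtained by repeatedly flipping the leftmost unmatched 0 (to ascend) or the rightmost unmatched 1 (to descend) until no unmatched bit can be flipped. Equivalently, let $D$ be the set of bitstrings (including the empty string) with equally many 0s and 1s such that every prefix has at least as many 0s as 1s; each chain is encoded as a string $u_0*u_1*\cdots *u_h$ with $u_0,\ldots,u_h\in D$, and its vertices are $u_0\,1\cdots u_{i-1}\,1\,u_i\,0\,u_{i+1}\cdots 0\,u_h$ for $i=0,\ldots,h$. -}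

module Defs where

open import Data.Bool using (Bool; true; false; not; if_then_else_; _xor_)
open import Data.Nat using (ℕ; zero; suc; _+_; _^_; _≤_)
open import Data.Nat.DivMod using (_%_; m%n<n)
open import Data.Fin using (Fin; toℕ; fromℕ<)
open import Data.Vec using (Vec; []; _∷_)
open import Data.Maybe using (Maybe; just; nothing)
open import Data.Product using (Σ; _×_; _,_; ∃)
open import Data.Sum using (_⊎_)
open import Relation.Binary.PropositionalEquality using (_≡_)
open import Function.Definitions using (Bijective)

-- Vertices of Q_n: bitstrings of length n.  false = 0, true = 1.
Vertex : ℕ → Set
Vertex n = Vec Bool n

hamming : ∀ {n} → Vertex n → Vertex n → ℕ
hamming []       []       = 0
hamming (a ∷ xs) (b ∷ ys) = (if a xor b then 1 else 0) + hamming xs ys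

Adjacent : ∀ {n} → Vertex n → Vertex n → Set
Adjacent x y = hamming x y ≡ 1

-- Bracket matching (0 = opening, 1 = closing), scanning right to left.
-- Returns, for each position, whether it is an UNMATCHED 0, together with
-- the number of still-pending (not yet matched) 1s.
unmatched0 : ∀ {n} → Vertex n → Vec Bool n × ℕ
unmatched0 [] = ([] , 0)
unmatched0 (b ∷ xs) with unmatched0 xs
... | (fs , c) with b
...   | true  = (false ∷ fs , suc c)
...   | false with c
...     | zero   = (true ∷ fs , 0)
...     | suc c' = (false ∷ fs , c')

flipFirst : ∀ {n} → Vec Bool n → Vertex n → Maybe (Vertex n)
flipFirst []          []       = nothing
flipFirst (true ∷ fs) (b ∷ xs) = just (not b ∷ xs)
flipFirst (false ∷ fs) (b ∷ xs) with flipFirst fs xs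
... | just ys = just (b ∷ ys)
... | nothing = nothing

gkUp : ∀ {n} → Vertex n → Maybe (Vertex n)
gkUp x with unmatched0 x
... | (fs , _) = flipFirst fs x

GKEdge : ∀ {n} → Vertex n → Vertex n → Set
GKEdge x y = gkUp x ≡ just y

csuc : ∀ {m} → Fin m → Fin m
csuc {suc m} i = fromℕ< (m%n<n (suc (toℕ i)) (suc m))

record HamiltonCycle (n : ℕ) : Set where
  field
    vertex    : Fin (2 ^ n) → Vertex n
    bijective : Bijective _≡_ _≡_ vertex
    adjacent  : ∀ i → Adjacent (vertex i) (vertex (csuc i))

CycleEdge : ∀ {n} → HamiltonCycle n → Vertex n → Vertex n → Set
CycleEdge C x y =
  ∃ λ i → (vertex i ≡ x × vertex (csuc i) ≡ y) ⊎ (vertex i ≡ y × vertex (csuc i) ≡ x)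
  where open HamiltonCycle C

-- A Greene–Kleitman chain x₀ … xₜ of Q_n gives the two chains 0x₀ 1x₀ … 1xₜ and
-- 0x₁ … 0xₜ of Q_(n+1). For even n all chains have odd length, and we maintain a
-- top cycle: the chains of Q_n grouped into pairs (c, d) whose tops, in the order
-- c₁ d₁ c₂ d₂ …, form a closed walk. Replacing each chain c by the ladder down 1c,
-- across its bottom and up 0c (and each d by the reversed ladder) turns a top cycle
-- into a Hamilton cycle of Q_(n+1) through every chain edge; doing the same with the
-- ladders of the two children of each chain gives one of Q_(n+2). A top cycle of Q_n
-- yields one of Q_(n+2) by replacing every chain by its grandchildren, whose tops
-- 00t 01t 10t 11t can be visited in a suitable order; the induction starts from the
-- chains 00 10 11 and 01 of Q_2.

module Submission where

open import Defs
open import Data.Nat using (ℕ; zero; suc; pred; _+_; _^_; _≤_; _≥_; z≤n; s≤s)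
open import Data.Nat.Properties using (+-identityʳ; +-comm; +-assoc; +-suc; m≤n+m; ≤-trans; ≤-reflexive)
open import Data.Nat.DivMod using (_%_; m<n⇒m%n≡m; n%n≡0)
open import Data.Nat.Tactic.RingSolver using (solve-∀)
open import Data.Bool using (Bool; true; false; not; _xor_; if_then_else_)
import Data.Bool as Bool
open import Data.Bool.Properties using (xor-same)
open import Data.Empty using (⊥)
open import Data.Unit using (⊤; tt)
open import Data.Product using (Σ; _×_; _,_; proj₁; proj₂; ∃; ∃₂)
open import Data.Sum using (_⊎_; inj₁; inj₂)
import Data.Sum as Sum
open import Data.Maybe using (Maybe; just; nothing)
import Data.Maybe as Maybe
open import Data.Maybe.Properties using (just-injective)
open import Data.Fin using (Fin; fromℕ; inject₁) renaming (zero to fzero; suc to fsuc)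
open import Data.Fin.Properties using (toℕ-injective; toℕ-fromℕ<; toℕ-fromℕ; toℕ-inject₁; inject₁ℕ<)
open import Data.Vec using ([]; _∷_; replicate)
open import Data.Vec.Properties using (≡-dec)
open import Data.List using (List; []; _∷_; [_]; _++_; _∷ʳ_; map; reverse; length; concat; sum; lookup)
open import Data.List.Properties using (reverse-++; unfold-reverse; ++-assoc; map-++; concat-++)
open import Data.List.Membership.Propositional using (_∈_)
open import Data.List.Membership.Propositional.Properties
  using (∈-++⁻; ∈-++⁺ˡ; ∈-++⁺ʳ; ∈-map⁺; ∈-concat⁻′; ∈-lookup)
open import Data.List.Relation.Unary.Any using (here; there; index)
open import Data.List.Relation.Unary.Any.Properties using (lookup-index)
open import Data.List.Relation.Unary.All using (All; []; _∷_)
import Data.List.Relation.Unary.All as All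
import Data.List.Relation.Unary.All.Properties as All
open import Function using (_∘_)
open import Function.Definitions using (Bijective)
open import Function.Consequences.Propositional using (strictlySurjective⇒surjective)
open import Level using (0ℓ)
open import Relation.Nullary using (¬_; does; yes; no; contradiction)
open import Relation.Binary using (Rel; DecidableEquality; Symmetric)
open import Relation.Binary.PropositionalEquality hiding ([_])

variable
  n : ℕ

-- Adjacency and the Greene–Kleitman ascent

xor-comm : ∀ a b → a xor b ≡ b xor a
xor-comm false false = refl
xor-comm false true  = refl
xor-comm true  false = refl
xor-comm true  true  = refl

hamming-refl : (x : Vertex n) → hamming x x ≡ 0
hamming-refl []      = refl
hamming-refl (b ∷ x) rewrite xor-same b = hamming-refl x

hamming-sym : (x y : Vertex n) → hamming x y ≡ hamming y x
hamming-sym []      []      = refl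
hamming-sym (a ∷ x) (b ∷ y) rewrite xor-comm a b = cong (_ +_) (hamming-sym x y)

Adjacent-sym : (x y : Vertex n) → Adjacent x y → Adjacent y x
Adjacent-sym x y x~y = trans (hamming-sym y x) x~y

∷-Adjacent : ∀ b (x y : Vertex n) → Adjacent x y → Adjacent (b ∷ x) (b ∷ y)
∷-Adjacent b x y x~y rewrite xor-same b = x~y

flip-Adjacent : ∀ b (x : Vertex n) → Adjacent (b ∷ x) (not b ∷ x)
flip-Adjacent false x = cong suc (hamming-refl x)
flip-Adjacent true  x = cong suc (hamming-refl x)

-- The number of 1s of x left unmatched inside x: x is the bottom of its chain iff it is 0.
pending : Vertex n → ℕ
pending x = proj₂ (unmatched0 x)

pending-true : (x : Vertex n) → pending (true ∷ x) ≡ suc (pending x)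
pending-true x with unmatched0 x
... | _ , _ = refl

pending-false : (x : Vertex n) → pending (false ∷ x) ≡ pred (pending x)
pending-false x with unmatched0 x
... | _ , zero  = refl
... | _ , suc _ = refl

gkUp-true : (x : Vertex n) → gkUp (true ∷ x) ≡ Maybe.map (true ∷_) (gkUp x)
gkUp-true x with unmatched0 x
... | fs , _ with flipFirst fs x
...   | just _  = refl
...   | nothing = refl

gkUp-false-unmatched : (x : Vertex n) → pending x ≡ 0 → gkUp (false ∷ x) ≡ just (true ∷ x)
gkUp-false-unmatched x p with unmatched0 x
gkUp-false-unmatched x refl | _ , zero = refl

gkUp-false-matched : (x : Vertex n) {k : ℕ} → pending x ≡ suc k →
                     gkUp (false ∷ x) ≡ Maybe.map (false ∷_) (gkUp x)
gkUp-false-matched x p with unmatched0 x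
gkUp-false-matched x refl | fs , suc _ with flipFirst fs x
... | just _  = refl
... | nothing = refl

map-≡-just : ∀ {A B : Set} (f : A → B) (m : Maybe A) {y} → Maybe.map f m ≡ just y →
             ∃ λ x → m ≡ just x × f x ≡ y
map-≡-just f (just x) refl = x , refl , refl

data Ascent {n : ℕ} : Vertex (suc n) → Vertex (suc n) → Set where
  under-true  : ∀ x {y} → gkUp x ≡ just y → Ascent (true ∷ x) (true ∷ y)
  flip-head   : ∀ x → pending x ≡ 0 → Ascent (false ∷ x) (true ∷ x)
  under-false : ∀ x {y k} → pending x ≡ suc k → gkUp x ≡ just y → Ascent (false ∷ x) (false ∷ y)

ascent : (x : Vertex (suc n)) {y : Vertex (suc n)} → gkUp x ≡ just y → Ascent x y
ascent (true ∷ x) up with map-≡-just (true ∷_) (gkUp x) (trans (sym (gkUp-true x)) up)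
... | _ , up′ , refl = under-true x up′
ascent (false ∷ x) {y} up = by-pending (pending x) refl
  where
  by-pending : ∀ k → pending x ≡ k → Ascent (false ∷ x) y
  by-pending zero p with refl ← trans (sym (gkUp-false-unmatched x p)) up = flip-head x p
  by-pending (suc _) p with map-≡-just (false ∷_) (gkUp x) (trans (sym (gkUp-false-matched x p)) up)
  ... | _ , up′ , refl = under-false x p up′

gkUp-Adjacent : (x : Vertex n) {y : Vertex n} → gkUp x ≡ just y → Adjacent x y
gkUp-Adjacent (b ∷ x) up with ascent (b ∷ x) up
... | under-true x {y} up′    = ∷-Adjacent true x y (gkUp-Adjacent x up′)
... | flip-head x _           = flip-Adjacent false x
... | under-false x {y} _ up′ = ∷-Adjacent false x y (gkUp-Adjacent x up′)

gkUp-pending : (x : Vertex n) {y : Vertex n} → gkUp x ≡ just y → pending y ≡ suc (pending x)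
gkUp-pending (b ∷ x) up with ascent (b ∷ x) up
... | under-true x {y} up′ = begin
  pending (true ∷ y)       ≡⟨ pending-true y ⟩
  suc (pending y)          ≡⟨ cong suc (gkUp-pending x up′) ⟩
  suc (suc (pending x))    ≡⟨ cong suc (pending-true x) ⟨
  suc (pending (true ∷ x)) ∎
  where open ≡-Reasoning
... | flip-head x p = begin
  pending (true ∷ x)        ≡⟨ pending-true x ⟩
  suc (pending x)           ≡⟨ cong suc p ⟩
  1                         ≡⟨ cong (suc ∘ pred) p ⟨
  suc (pred (pending x))    ≡⟨ cong suc (pending-false x) ⟨
  suc (pending (false ∷ x)) ∎
  where open ≡-Reasoning
... | under-false x {y} p up′ = begin
  pending (false ∷ y)       ≡⟨ pending-false y ⟩
  pred (pending y)          ≡⟨ cong pred (gkUp-pending x up′) ⟩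
  pending x                 ≡⟨ p ⟩
  suc _                     ≡⟨ cong (suc ∘ pred) p ⟨
  suc (pred (pending x))    ≡⟨ cong suc (pending-false x) ⟨
  suc (pending (false ∷ x)) ∎
  where open ≡-Reasoning

-- Walks and consecutive pairs in lists

module _ {A : Set} where

  data Walk (R : Rel A 0ℓ) : A → A → List A → Set where
    stay : ∀ a → Walk R a a (a ∷ [])
    move : ∀ {a b c xs} → R a b → Walk R b c (b ∷ xs) → Walk R a c (a ∷ b ∷ xs)

  module _ {R : Rel A 0ℓ} where

    walk-cons : ∀ {a b c xs} → R a b → Walk R b c xs → Walk R a c (a ∷ xs)
    walk-cons r (stay _)   = move r (stay _)
    walk-cons r (move s w) = move r (move s w)

    walk-join : ∀ {a b c xs ys} → Walk R a b xs → Walk R b c (b ∷ ys) → Walk R a c (xs ++ ys)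
    walk-join (stay _)   w = w
    walk-join (move r v) w = move r (walk-join v w)

    walk-reverse : Symmetric R → ∀ {a b xs} → Walk R a b xs → Walk R b a (reverse xs)
    walk-reverse R-sym (stay a) = stay a
    walk-reverse R-sym (move {a = a} {b = b} {xs = xs} r w) =
      subst (Walk R _ a) (sym (unfold-reverse a (b ∷ xs))) (walk-join (walk-reverse R-sym w) (move (R-sym r) (stay a)))

  data Consecutive (x y : A) : List A → Set where
    now   : ∀ {zs} → Consecutive x y (x ∷ y ∷ zs)
    later : ∀ {z zs} → Consecutive x y zs → Consecutive x y (z ∷ zs)

  consecutive-++⁺ˡ : ∀ {x y xs} ys → Consecutive x y xs → Consecutive x y (xs ++ ys)
  consecutive-++⁺ˡ ys now       = now
  consecutive-++⁺ˡ ys (later c) = later (consecutive-++⁺ˡ ys c)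

  consecutive-++⁺ʳ : ∀ {x y} xs {ys} → Consecutive x y ys → Consecutive x y (xs ++ ys)
  consecutive-++⁺ʳ []       c = c
  consecutive-++⁺ʳ (_ ∷ xs) c = later (consecutive-++⁺ʳ xs c)

  consecutive-split : ∀ {x y xs} → Consecutive x y xs → ∃₂ λ pre post → xs ≡ pre ++ x ∷ y ∷ post
  consecutive-split (now {zs}) = [] , zs , refl
  consecutive-split (later {z} c) with consecutive-split c
  ... | pre , post , refl = z ∷ pre , post , refl

  consecutive-reverse⁺ : ∀ {x y xs} → Consecutive x y xs → Consecutive y x (reverse xs)
  consecutive-reverse⁺ {x} {y} c with consecutive-split c
  ... | pre , post , refl = subst (Consecutive y x) (sym reverse-split)
                              (consecutive-++⁺ʳ (reverse post) now)
    where
    open ≡-Reasoning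
    reverse-split : reverse (pre ++ x ∷ y ∷ post) ≡ reverse post ++ y ∷ x ∷ reverse pre
    reverse-split = begin
      reverse (pre ++ x ∷ y ∷ post)              ≡⟨ reverse-++ pre (x ∷ y ∷ post) ⟩
      reverse (x ∷ y ∷ post) ++ reverse pre      ≡⟨ cong (_++ reverse pre) (reverse-++ (x ∷ y ∷ []) post) ⟩
      (reverse post ++ y ∷ x ∷ []) ++ reverse pre ≡⟨ ++-assoc (reverse post) (y ∷ x ∷ []) (reverse pre) ⟩
      reverse post ++ y ∷ x ∷ reverse pre        ∎

  consecutive-∷ʳ-++ : ∀ {x y} xs ys → Consecutive x y ((xs ∷ʳ x) ++ y ∷ ys)
  consecutive-∷ʳ-++ {x} {y} xs ys =
    subst (Consecutive x y) (sym (++-assoc xs (x ∷ []) (y ∷ ys))) (consecutive-++⁺ʳ xs now)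

  Joined : A → A → List A → Set
  Joined x y xs = Consecutive x y xs ⊎ Consecutive y x xs

  joined-++⁺ˡ : ∀ {x y xs} ys → Joined x y xs → Joined x y (xs ++ ys)
  joined-++⁺ˡ ys (inj₁ c) = inj₁ (consecutive-++⁺ˡ ys c)
  joined-++⁺ˡ ys (inj₂ c) = inj₂ (consecutive-++⁺ˡ ys c)

  joined-++⁺ʳ : ∀ {x y} xs {ys} → Joined x y ys → Joined x y (xs ++ ys)
  joined-++⁺ʳ xs (inj₁ c) = inj₁ (consecutive-++⁺ʳ xs c)
  joined-++⁺ʳ xs (inj₂ c) = inj₂ (consecutive-++⁺ʳ xs c)

  joined-reverse⁺ : ∀ {x y xs} → Joined x y xs → Joined x y (reverse xs)
  joined-reverse⁺ (inj₁ c) = inj₂ (consecutive-reverse⁺ c)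
  joined-reverse⁺ (inj₂ c) = inj₁ (consecutive-reverse⁺ c)

walk-map : ∀ {A B : Set} {R : Rel A 0ℓ} {S : Rel B 0ℓ} (f : A → B) → (∀ {x y} → R x y → S (f x) (f y)) →
           ∀ {a b xs} → Walk R a b xs → Walk S (f a) (f b) (map f xs)
walk-map f f⁺ (stay a)   = stay (f a)
walk-map f f⁺ (move r w) = move (f⁺ r) (walk-map f f⁺ w)

consecutive-map⁺ : ∀ {A B : Set} (f : A → B) {x y xs} → Consecutive x y xs → Consecutive (f x) (f y) (map f xs)
consecutive-map⁺ f now       = now
consecutive-map⁺ f (later c) = later (consecutive-map⁺ f c)

-- Multiplicities and enumerations of Q_n

module Multiplicity {A : Set} (_≟_ : DecidableEquality A) where

  hit : A → A → ℕ
  hit v x = if does (v ≟ x) then 1 else 0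

  occ : A → List A → ℕ
  occ v []       = 0
  occ v (x ∷ xs) = hit v x + occ v xs

  occ-++ : ∀ v xs ys → occ v (xs ++ ys) ≡ occ v xs + occ v ys
  occ-++ v []       ys = refl
  occ-++ v (x ∷ xs) ys = trans (cong (_ +_) (occ-++ v xs ys)) (sym (+-assoc (hit v x) (occ v xs) _))

  occ-++-comm : ∀ v xs ys → occ v (xs ++ ys) ≡ occ v (ys ++ xs)
  occ-++-comm v xs ys = trans (occ-++ v xs ys) (trans (+-comm (occ v xs) _) (sym (occ-++ v ys xs)))

  occ-reverse : ∀ v xs → occ v (reverse xs) ≡ occ v xs
  occ-reverse v []       = refl
  occ-reverse v (x ∷ xs) = begin
    occ v (reverse (x ∷ xs))   ≡⟨ cong (occ v) (unfold-reverse x xs) ⟩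
    occ v (reverse xs ++ [ x ]) ≡⟨ occ-++-comm v (reverse xs) [ x ] ⟩
    occ v (x ∷ reverse xs)     ≡⟨ cong (_ +_) (occ-reverse v xs) ⟩
    occ v (x ∷ xs)             ∎
    where open ≡-Reasoning

  occ-concat : ∀ v xss → occ v (concat xss) ≡ sum (map (occ v) xss)
  occ-concat v []         = refl
  occ-concat v (xs ∷ xss) = trans (occ-++ v xs (concat xss)) (cong (occ v xs +_) (occ-concat v xss))

  occ-∈ : ∀ {v xs k} → occ v xs ≡ suc k → v ∈ xs
  occ-∈ {v} {x ∷ xs} p with v ≟ x
  ... | yes refl = here refl
  ... | no _     = there (occ-∈ p)

  hit-refl : ∀ v → hit v v ≡ 1
  hit-refl v with v ≟ v
  ... | yes _  = refl
  ... | no v≢v = contradiction refl v≢v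

  ∈-occ : ∀ {v xs} → v ∈ xs → 1 ≤ occ v xs
  ∈-occ {v} {_ ∷ xs} (here refl) = subst (1 ≤_) (cong (_+ occ v xs) (sym (hit-refl v))) (s≤s z≤n)
  ∈-occ     (there v∈xs) = ≤-trans (∈-occ v∈xs) (m≤n+m _ _)

  repeated : ∀ {v xs} → v ∈ xs → ¬ occ v (v ∷ xs) ≤ 1
  repeated {v} {xs} v∈xs le with ≤-trans (s≤s (∈-occ v∈xs)) (subst (_≤ 1) (cong (_+ occ v xs) (hit-refl v)) le)
  ... | s≤s ()

  lookup-injective : ∀ xs → (∀ v → occ v xs ≤ 1) → ∀ i j → lookup xs i ≡ lookup xs j → i ≡ j
  lookup-injective (x ∷ xs) once fzero    fzero    _  = refl
  lookup-injective (x ∷ xs) once fzero    (fsuc j) eq =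
    contradiction (once x) (repeated (subst (_∈ xs) (sym eq) (∈-lookup j)))
  lookup-injective (x ∷ xs) once (fsuc i) fzero    eq =
    contradiction (once x) (repeated (subst (_∈ xs) eq (∈-lookup i)))
  lookup-injective (x ∷ xs) once (fsuc i) (fsuc j) eq =
    cong fsuc (lookup-injective xs (λ v → ≤-trans (m≤n+m _ _) (once v)) i j eq)

module VertexMultiplicity {n : ℕ} = Multiplicity (≡-dec {n = n} Bool._≟_)
open VertexMultiplicity

occ-map-∷ : ∀ b (v : Vertex n) xs → occ (b ∷ v) (map (b ∷_) xs) ≡ occ v xs
occ-map-∷ false v []       = refl
occ-map-∷ false v (x ∷ xs) = cong (_ +_) (occ-map-∷ false v xs)
occ-map-∷ true  v []       = refl
occ-map-∷ true  v (x ∷ xs) = cong (_ +_) (occ-map-∷ true v xs)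

occ-map-∷-other : ∀ b (v : Vertex n) xs → occ (b ∷ v) (map (not b ∷_) xs) ≡ 0
occ-map-∷-other false v []       = refl
occ-map-∷-other false v (x ∷ xs) = occ-map-∷-other false v xs
occ-map-∷-other true  v []       = refl
occ-map-∷-other true  v (x ∷ xs) = occ-map-∷-other true v xs

Enumerates : List (Vertex n) → Set
Enumerates {n} H = (v : Vertex n) → occ v H ≡ 1

fibre : Bool → List (Vertex (suc n)) → List (Vertex n)
fibre b []            = []
fibre b ((c ∷ v) ∷ H) = if does (b Bool.≟ c) then v ∷ fibre b H else fibre b H

occ-fibre : ∀ b (v : Vertex n) H → occ v (fibre b H) ≡ occ (b ∷ v) H
occ-fibre b     v []                  = refl
occ-fibre false v ((false ∷ _) ∷ H) = cong (_ +_) (occ-fibre false v H)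
occ-fibre false v ((true  ∷ _) ∷ H) = occ-fibre false v H
occ-fibre true  v ((false ∷ _) ∷ H) = occ-fibre true v H
occ-fibre true  v ((true  ∷ _) ∷ H) = cong (_ +_) (occ-fibre true v H)

length-fibres : (H : List (Vertex (suc n))) → length H ≡ length (fibre false H) + length (fibre true H)
length-fibres []                = refl
length-fibres ((false ∷ _) ∷ H) = cong suc (length-fibres H)
length-fibres ((true  ∷ _) ∷ H) = trans (cong suc (length-fibres H)) (sym (+-suc _ _))

occ-[] : (H : List (Vertex 0)) → occ [] H ≡ length H
occ-[] []       = refl
occ-[] ([] ∷ H) = cong suc (occ-[] H)

length-enumeration : ∀ n (H : List (Vertex n)) → Enumerates H → length H ≡ 2 ^ n
length-enumeration zero    H once = trans (sym (occ-[] H)) (once [])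
length-enumeration (suc n) H once = begin
  length H
    ≡⟨ length-fibres H ⟩
  length (fibre false H) + length (fibre true H)
    ≡⟨ cong₂ _+_ (length-enumeration n (fibre false H) (fibre-enumerates false))
                 (length-enumeration n (fibre true H) (fibre-enumerates true)) ⟩
  2 ^ n + 2 ^ n
    ≡⟨ cong (2 ^ n +_) (+-identityʳ (2 ^ n)) ⟨
  2 ^ suc n
    ∎
  where
  open ≡-Reasoning
  fibre-enumerates : ∀ b → Enumerates (fibre b H)
  fibre-enumerates b v = trans (occ-fibre b v H) (once (b ∷ v))

-- Chains and their children

-- Chains are listed from the bottom up.
AscendsToTop : List (Vertex n) → Set
AscendsToTop []          = ⊤
AscendsToTop (x ∷ [])    = gkUp x ≡ nothing
AscendsToTop (x ∷ y ∷ r) = gkUp x ≡ just y × AscendsToTop (y ∷ r)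

IsChain : List (Vertex n) → Set
IsChain []      = ⊥
IsChain (x ∷ r) = pending x ≡ 0 × AscendsToTop (x ∷ r)

top : List (Vertex n) → Vertex n
top {n} []      = replicate n false
top (x ∷ [])    = x
top (_ ∷ y ∷ r) = top (y ∷ r)

top-map : ∀ b (x : Vertex n) r → top (map (b ∷_) (x ∷ r)) ≡ b ∷ top (x ∷ r)
top-map b x []      = refl
top-map b x (y ∷ r) = top-map b y r

ascends-consecutive : ∀ (c : List (Vertex n)) {x y} → AscendsToTop c → x ∈ c → gkUp x ≡ just y → Consecutive x y c
ascends-consecutive (x ∷ []) atTop (here refl) up with () ← trans (sym atTop) up
ascends-consecutive (x ∷ y ∷ r) (up′ , _) (here refl) up with refl ← just-injective (trans (sym up′) up) = now
ascends-consecutive (x ∷ y ∷ r) (_ , a) (there x∈) up = later (ascends-consecutive (y ∷ r) a x∈ up)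

bottom-unique : ∀ (x : Vertex n) r {u} → AscendsToTop (x ∷ r) → u ∈ x ∷ r → pending u ≡ 0 → u ≡ x
bottom-unique x r       a        (here refl) p = refl
bottom-unique x (y ∷ r) (up , a) (there u∈) p with refl ← bottom-unique y r a u∈ p
  with () ← trans (sym p) (gkUp-pending x up)

ascends-walk : ∀ (x : Vertex n) r → AscendsToTop (x ∷ r) → Walk Adjacent x (top (x ∷ r)) (x ∷ r)
ascends-walk x []      _        = stay x
ascends-walk x (y ∷ r) (up , a) = move (gkUp-Adjacent x up) (ascends-walk y r a)

ascends-map-true : (c : List (Vertex n)) → AscendsToTop c → AscendsToTop (map (true ∷_) c)
ascends-map-true []          _        = tt
ascends-map-true (x ∷ [])    up       = trans (gkUp-true x) (cong (Maybe.map _) up)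
ascends-map-true (x ∷ y ∷ r) (up , a) = trans (gkUp-true x) (cong (Maybe.map _) up) , ascends-map-true (y ∷ r) a

ascends-map-false : ∀ (x : Vertex n) r {k} → pending x ≡ suc k → AscendsToTop (x ∷ r) →
                    AscendsToTop (map (false ∷_) (x ∷ r))
ascends-map-false x []      p up       = trans (gkUp-false-matched x p) (cong (Maybe.map _) up)
ascends-map-false x (y ∷ r) p (up , a) =
  trans (gkUp-false-matched x p) (cong (Maybe.map _) up) , ascends-map-false y r (gkUp-pending x up) a

longChild : List (Vertex n) → List (Vertex (suc n))
longChild []      = []
longChild (x ∷ r) = (false ∷ x) ∷ map (true ∷_) (x ∷ r)

shortChild : List (Vertex n) → List (Vertex (suc n))
shortChild []      = []
shortChild (_ ∷ r) = map (false ∷_) r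

longChild-chain : (c : List (Vertex n)) → IsChain c → IsChain (longChild c)
longChild-chain (x ∷ r) (p , a) =
  trans (pending-false x) (cong pred p) , gkUp-false-unmatched x p , ascends-map-true (x ∷ r) a

shortChild-chain : ∀ (x y : Vertex n) r → IsChain (x ∷ y ∷ r) → IsChain (shortChild (x ∷ y ∷ r))
shortChild-chain x y r (p , up , a) =
  trans (pending-false y) (trans (cong pred (gkUp-pending x up)) p) ,
  ascends-map-false y r (trans (gkUp-pending x up) (cong suc p)) a

top-longChild : ∀ (x : Vertex n) r → top (longChild (x ∷ r)) ≡ true ∷ top (x ∷ r)
top-longChild = top-map true

top-shortChild : ∀ (x y : Vertex n) r → top (shortChild (x ∷ y ∷ r)) ≡ false ∷ top (x ∷ y ∷ r)
top-shortChild x = top-map false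

occ-children : ∀ b (v : Vertex n) c → occ (b ∷ v) (shortChild c ++ longChild c) ≡ occ v c
occ-children b     v []      = refl
occ-children false v (x ∷ r) = begin
  occ (false ∷ v) (map (false ∷_) r ++ longChild (x ∷ r))        ≡⟨ occ-++ _ (map (false ∷_) r) _ ⟩
  occ (false ∷ v) (map (false ∷_) r) + (hit v x + occ (false ∷ v) (map (true ∷_) (x ∷ r)))
    ≡⟨ cong₂ (λ a b → a + (hit v x + b)) (occ-map-∷ false v r) (occ-map-∷-other false v (x ∷ r)) ⟩
  occ v r + (hit v x + 0)                                         ≡⟨ cong (occ v r +_) (+-identityʳ _) ⟩
  occ v r + hit v x                                               ≡⟨ +-comm (occ v r) _ ⟩
  occ v (x ∷ r)                                                   ∎
  where open ≡-Reasoning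
occ-children true  v (x ∷ r) = begin
  occ (true ∷ v) (map (false ∷_) r ++ longChild (x ∷ r))          ≡⟨ occ-++ _ (map (false ∷_) r) _ ⟩
  occ (true ∷ v) (map (false ∷_) r) + occ (true ∷ v) (map (true ∷_) (x ∷ r))
    ≡⟨ cong₂ _+_ (occ-map-∷-other true v r) (occ-map-∷ true v (x ∷ r)) ⟩
  occ v (x ∷ r)                                                   ∎
  where open ≡-Reasoning

∈-children : ∀ b {x : Vertex n} c → x ∈ c → (b ∷ x) ∈ shortChild c ++ longChild c
∈-children false (x ∷ r) (here refl) = ∈-++⁺ʳ (map (false ∷_) r) (here refl)
∈-children false (x ∷ r) (there x∈)  = ∈-++⁺ˡ (∈-map⁺ (false ∷_) x∈)
∈-children true  (x ∷ r) x∈          = ∈-++⁺ʳ (map (false ∷_) r) (there (∈-map⁺ (true ∷_) x∈))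

prefix-walk : ∀ b {a z : Vertex n} {xs} → Walk Adjacent a z xs → Walk Adjacent (b ∷ a) (b ∷ z) (map (b ∷_) xs)
prefix-walk b = walk-map (b ∷_) (λ {x} {y} → ∷-Adjacent b x y)

reverse-walk : {a z : Vertex n} {xs : List (Vertex n)} → Walk Adjacent a z xs → Walk Adjacent z a (reverse xs)
reverse-walk = walk-reverse (λ {x} {y} → Adjacent-sym x y)

ladder : List (Vertex n) → List (Vertex (suc n))
ladder c = map (true ∷_) (reverse c) ++ map (false ∷_) c

ladder-walk : (c : List (Vertex n)) → IsChain c → Walk Adjacent (true ∷ top c) (false ∷ top c) (ladder c)
ladder-walk (x ∷ r) (_ , a) =
  walk-join (prefix-walk true (reverse-walk chain))
            (move (flip-Adjacent true x) (prefix-walk false chain))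
  where
  chain : Walk Adjacent x (top (x ∷ r)) (x ∷ r)
  chain = ascends-walk x r a

Covers : List (Vertex (suc n)) → List (Vertex n) → Set
Covers H c = ∀ b x {y} → x ∈ c → gkUp (b ∷ x) ≡ just y → Joined (b ∷ x) y H

-- Ascents inside a copy b·c run along its side of the ladder; the only other one,
-- flipping the leading 0 of the bottom, is the rung.
ladder-covers : (c : List (Vertex n)) → IsChain c → Covers (ladder c) c
ladder-covers (h ∷ r) (_ , a) b x x∈ up with ascent (b ∷ x) up
... | under-true _ up′ =
  inj₂ (consecutive-++⁺ˡ _ (consecutive-map⁺ (true ∷_)
         (consecutive-reverse⁺ (ascends-consecutive (h ∷ r) a x∈ up′))))
... | under-false _ _ up′ =
  inj₁ (consecutive-++⁺ʳ _ (consecutive-map⁺ (false ∷_) (ascends-consecutive (h ∷ r) a x∈ up′)))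
... | flip-head _ p with refl ← bottom-unique h r a x∈ p =
  inj₂ (subst (Consecutive _ _) ladder≡ (consecutive-∷ʳ-++ (map (true ∷_) (reverse r)) (map (false ∷_) r)))
  where
  ladder≡ : (map (true ∷_) (reverse r) ∷ʳ (true ∷ h)) ++ map (false ∷_) (h ∷ r) ≡ ladder (h ∷ r)
  ladder≡ = cong (_++ map (false ∷_) (h ∷ r))
                 (sym (trans (cong (map _) (unfold-reverse h r)) (map-++ _ (reverse r) [ h ])))

occ-ladder : ∀ b (v : Vertex n) c → occ (b ∷ v) (ladder c) ≡ occ v c
occ-ladder false v c = trans (occ-++ _ (map (true ∷_) (reverse c)) _)
                             (cong₂ _+_ (occ-map-∷-other false v (reverse c)) (occ-map-∷ false v c))
occ-ladder true  v c = begin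
  occ (true ∷ v) (ladder c)
    ≡⟨ occ-++ _ (map (true ∷_) (reverse c)) _ ⟩
  occ (true ∷ v) (map (true ∷_) (reverse c)) + occ (true ∷ v) (map (false ∷_) c)
    ≡⟨ cong₂ _+_ (occ-map-∷ true v (reverse c)) (occ-map-∷-other true v c) ⟩
  occ v (reverse c) + 0
    ≡⟨ +-identityʳ _ ⟩
  occ v (reverse c)
    ≡⟨ occ-reverse v c ⟩
  occ v c
    ∎
  where open ≡-Reasoning

-- Top cycles and the tours they induce

ChainPair : ℕ → Set
ChainPair n = List (Vertex n) × List (Vertex n)

components : List (ChainPair n) → List (List (Vertex n))
components []             = []
components ((c , d) ∷ ps) = c ∷ d ∷ components ps

vertices : List (ChainPair n) → List (Vertex n)
vertices ps = concat (components ps)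

occ-vertices-∷ : ∀ (v : Vertex n) c d ps → occ v (vertices ((c , d) ∷ ps)) ≡ occ v c + (occ v d + occ v (vertices ps))
occ-vertices-∷ v c d ps = trans (occ-++ v c _) (cong (occ v c +_) (occ-++ v d _))

tops : List (ChainPair n) → List (Vertex n)
tops ps = map top (components ps)

weave : ∀ {m} → (List (Vertex n) → List (Vertex m)) → List (ChainPair n) → List (Vertex m)
weave F []             = []
weave F ((c , d) ∷ ps) = F c ++ reverse (F d) ++ weave F ps

module _ {m : ℕ} (F : List (Vertex n) → List (Vertex m)) where

  occ-weave : ∀ w (v : Vertex n) → (∀ c → occ w (F c) ≡ occ v c) →
              ∀ ps → occ w (weave F ps) ≡ occ v (vertices ps)
  occ-weave w v occ-F []             = refl
  occ-weave w v occ-F ((c , d) ∷ ps) = begin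
    occ w (F c ++ reverse (F d) ++ weave F ps)
      ≡⟨ trans (occ-++ w (F c) _) (cong (occ w (F c) +_) (occ-++ w (reverse (F d)) _)) ⟩
    occ w (F c) + (occ w (reverse (F d)) + occ w (weave F ps))
      ≡⟨ cong₂ _+_ (occ-F c) (cong₂ _+_ (trans (occ-reverse w (F d)) (occ-F d)) (occ-weave w v occ-F ps)) ⟩
    occ v c + (occ v d + occ v (vertices ps))
      ≡⟨ occ-vertices-∷ v c d ps ⟨
    occ v (vertices ((c , d) ∷ ps))
      ∎
    where open ≡-Reasoning

  module _ (enter leave : Vertex n → Vertex m)
           (enter-Adjacent : ∀ x y → Adjacent x y → Adjacent (enter x) (enter y))
           (leave-Adjacent : ∀ x y → Adjacent x y → Adjacent (leave x) (leave y))
           (F-walk : ∀ c → IsChain c → Walk Adjacent (enter (top c)) (leave (top c)) (F c)) where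

    weave-walk : ∀ ps {a z} → All IsChain (components ps) → Walk Adjacent a z (a ∷ tops ps) →
                 Walk Adjacent (enter a) (enter z) (enter a ∷ weave F ps)
    weave-walk []             _                            (stay _)                  = stay _
    weave-walk ((c , d) ∷ ps) {a} (c-chain ∷ d-chain ∷ chains) (move a~c (move c~d walk)) =
      walk-cons (enter-Adjacent a (top c) a~c)
        (walk-join (F-walk c c-chain)
          (walk-cons (leave-Adjacent (top c) (top d) c~d)
            (walk-join (reverse-walk (F-walk d d-chain)) (weave-walk ps chains walk))))

  weave-joined : ∀ ps {c x y} → c ∈ components ps → Joined x y (F c) → Joined x y (weave F ps)
  weave-joined ((c , d) ∷ ps) (here refl)         j = joined-++⁺ˡ _ j
  weave-joined ((c , d) ∷ ps) (there (here refl)) j = joined-++⁺ʳ (F c) (joined-++⁺ˡ _ (joined-reverse⁺ j))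
  weave-joined ((c , d) ∷ ps) (there (there c∈))  j =
    joined-++⁺ʳ (F c) (joined-++⁺ʳ (reverse (F d)) (weave-joined ps c∈ j))

data OddLength {A : Set} : List A → Set where
  one      : ∀ {x} → OddLength (x ∷ [])
  two-more : ∀ {x y xs} → OddLength xs → OddLength (x ∷ y ∷ xs)

oddLength-map : ∀ {A B : Set} (f : A → B) {xs} → OddLength xs → OddLength (map f xs)
oddLength-map f one          = one
oddLength-map f (two-more o) = two-more (oddLength-map f o)

OddChain : List (Vertex n) → Set
OddChain c = IsChain c × OddLength c

record TopCycle (n : ℕ) : Set where
  field
    pairs      : List (ChainPair n)
    odd-chains : All OddChain (components pairs)
    enumerates : Enumerates (vertices pairs)
    base       : Vertex n
    closed     : Walk Adjacent base base (base ∷ tops pairs)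

  chains : All IsChain (components pairs)
  chains = All.map proj₁ odd-chains

  component : (x : Vertex n) → ∃ λ c → x ∈ c × c ∈ components pairs
  component x = ∈-concat⁻′ (components pairs) (occ-∈ (enumerates x))

record GKTour (n : ℕ) : Set where
  field
    tour       : List (Vertex n)
    enumerates : Enumerates tour
    base       : Vertex n
    closed     : Walk Adjacent base base (base ∷ tour)
    covers     : ∀ x y → GKEdge x y → Joined x y tour

zigzagTour : TopCycle n → GKTour (suc n)
zigzagTour T = record
  { tour       = weave ladder pairs
  ; enumerates = λ { (b ∷ v) → trans (occ-weave ladder (b ∷ v) v (occ-ladder b v) pairs) (enumerates v) }
  ; base       = true ∷ base
  ; closed     = weave-walk ladder (true ∷_) (false ∷_) (∷-Adjacent true) (∷-Adjacent false) ladder-walk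
                            pairs chains closed
  ; covers     = λ { (b ∷ x) y up → let c , x∈c , c∈ = component x in
                     weave-joined ladder pairs c∈ (ladder-covers c (All.lookup chains c∈) b x x∈c up) }
  }
  where open TopCycle T

square : List (Vertex n) → List (Vertex (suc (suc n)))
square []               = []
square (x ∷ [])         =
  (false ∷ false ∷ x) ∷ (true ∷ false ∷ x) ∷ (true ∷ true ∷ x) ∷ (false ∷ true ∷ x) ∷ []
square c@(_ ∷ _ ∷ _)    = reverse (ladder (shortChild c)) ++ ladder (longChild c)

occ-square : ∀ o i (v : Vertex n) c → occ (o ∷ i ∷ v) (square c) ≡ occ v c
occ-square o     i     v []       = refl
occ-square false false v (x ∷ []) = refl
occ-square false true  v (x ∷ []) = refl
occ-square true  false v (x ∷ []) = refl
occ-square true  true  v (x ∷ []) = refl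
occ-square {n} o     i     v c@(_ ∷ _ ∷ _) = begin
  occ w (reverse (ladder (shortChild c)) ++ ladder (longChild c))
    ≡⟨ occ-++ w (reverse (ladder (shortChild c))) _ ⟩
  occ w (reverse (ladder (shortChild c))) + occ w (ladder (longChild c))
    ≡⟨ cong₂ _+_ (trans (occ-reverse w (ladder (shortChild c))) (occ-ladder o (i ∷ v) (shortChild c)))
                 (occ-ladder o (i ∷ v) (longChild c)) ⟩
  occ (i ∷ v) (shortChild c) + occ (i ∷ v) (longChild c)
    ≡⟨ occ-++ (i ∷ v) (shortChild c) _ ⟨
  occ (i ∷ v) (shortChild c ++ longChild c)
    ≡⟨ occ-children i v c ⟩
  occ v c
    ∎
  where
  open ≡-Reasoning
  w : Vertex (suc (suc n))
  w = o ∷ i ∷ v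

square-walk : (c : List (Vertex n)) → IsChain c →
              Walk Adjacent (false ∷ false ∷ top c) (false ∷ true ∷ top c) (square c)
square-walk (x ∷ []) _ =
  move (flip-Adjacent false (false ∷ x))
    (move (∷-Adjacent true (false ∷ x) (true ∷ x) (flip-Adjacent false x))
      (move (flip-Adjacent true (true ∷ x)) (stay _)))
square-walk c@(x ∷ y ∷ r) chain =
  walk-join (reverse-walk (ladder-walk-at false (shortChild-chain x y r chain) (top-shortChild x y r)))
    (walk-cons (∷-Adjacent true (false ∷ top c) (true ∷ top c) (flip-Adjacent false (top c)))
      (ladder-walk-at true (longChild-chain c chain) (top-longChild x (y ∷ r))))
  where
  ladder-walk-at : ∀ {d} b → IsChain d → top d ≡ b ∷ top c →
                   Walk Adjacent (true ∷ b ∷ top c) (false ∷ b ∷ top c) (ladder d)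
  ladder-walk-at {d} b chain′ eq =
    subst (λ t → Walk Adjacent (true ∷ t) (false ∷ t) (ladder d)) eq (ladder-walk d chain′)

module _ (x : Vertex n) (bottom : pending x ≡ 0) (atTop : gkUp x ≡ nothing) where

  gkUp-00 : gkUp (false ∷ false ∷ x) ≡ just (true ∷ false ∷ x)
  gkUp-00 = gkUp-false-unmatched (false ∷ x) (trans (pending-false x) (cong pred bottom))

  gkUp-10 : gkUp (true ∷ false ∷ x) ≡ just (true ∷ true ∷ x)
  gkUp-10 = trans (gkUp-true (false ∷ x)) (cong (Maybe.map _) (gkUp-false-unmatched x bottom))

  gkUp-1 : gkUp (true ∷ x) ≡ nothing
  gkUp-1 = trans (gkUp-true x) (cong (Maybe.map _) atTop)

  gkUp-01 : gkUp (false ∷ true ∷ x) ≡ nothing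
  gkUp-01 = trans (gkUp-false-matched (true ∷ x) (pending-true x)) (cong (Maybe.map _) gkUp-1)

  gkUp-11 : gkUp (true ∷ true ∷ x) ≡ nothing
  gkUp-11 = trans (gkUp-true (true ∷ x)) (cong (Maybe.map _) gkUp-1)

square-covers : (c : List (Vertex n)) → IsChain c → Covers (square c) (shortChild c ++ longChild c)
square-covers (x ∷ []) (bottom , atTop) false .(false ∷ x) (here refl) up
  with refl ← trans (sym (gkUp-00 x bottom atTop)) up = inj₁ now
square-covers (x ∷ []) (bottom , atTop) true .(false ∷ x) (here refl) up
  with refl ← trans (sym (gkUp-10 x bottom atTop)) up = inj₁ (later now)
square-covers (x ∷ []) (bottom , atTop) false .(true ∷ x) (there (here refl)) up
  with () ← trans (sym (gkUp-01 x bottom atTop)) up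
square-covers (x ∷ []) (bottom , atTop) true .(true ∷ x) (there (here refl)) up
  with () ← trans (sym (gkUp-11 x bottom atTop)) up
square-covers c@(x ∷ y ∷ r) chain b x′ x′∈ up with ∈-++⁻ (shortChild c) x′∈
... | inj₁ x′∈S =
  joined-++⁺ˡ _ (joined-reverse⁺ (ladder-covers (shortChild c) (shortChild-chain x y r chain) b x′ x′∈S up))
... | inj₂ x′∈L =
  joined-++⁺ʳ (reverse (ladder (shortChild c))) (ladder-covers (longChild c) (longChild-chain c chain) b x′ x′∈L up)

gridTour : TopCycle n → GKTour (suc (suc n))
gridTour T = record
  { tour       = weave square pairs
  ; enumerates = λ { (o ∷ i ∷ v) → trans (occ-weave square (o ∷ i ∷ v) v (occ-square o i v) pairs) (enumerates v) }
  ; base       = false ∷ false ∷ base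
  ; closed     = weave-walk square (λ t → false ∷ false ∷ t) (λ t → false ∷ true ∷ t)
                            (λ x y → ∷-Adjacent false (false ∷ x) (false ∷ y) ∘ ∷-Adjacent false x y)
                            (λ x y → ∷-Adjacent false (true ∷ x) (true ∷ y) ∘ ∷-Adjacent true x y)
                            square-walk pairs chains closed
  ; covers     = λ { (o ∷ i ∷ x) y up → let c , x∈c , c∈ = component x in
                     weave-joined square pairs c∈
                       (square-covers c (All.lookup chains c∈) o (i ∷ x) (∈-children i c x∈c) up) }
  }
  where open TopCycle T

-- From a top cycle of Q_n to one of Q_(n+2)

module _ (c : List (Vertex n)) where

  LL SL LS SS : List (Vertex (suc (suc n)))
  LL = longChild (longChild c)
  SL = shortChild (longChild c)
  LS = longChild (shortChild c)
  SS = shortChild (shortChild c)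

  occ-grandchildren : ∀ o i v →
    occ (o ∷ i ∷ v) SS + occ (o ∷ i ∷ v) LS + (occ (o ∷ i ∷ v) SL + occ (o ∷ i ∷ v) LL) ≡ occ v c
  occ-grandchildren o i v = begin
    occ w SS + occ w LS + (occ w SL + occ w LL)
      ≡⟨ cong₂ _+_ (occ-++ w SS LS) (occ-++ w SL LL) ⟨
    occ w (SS ++ LS) + occ w (SL ++ LL)
      ≡⟨ cong₂ _+_ (occ-children o (i ∷ v) (shortChild c)) (occ-children o (i ∷ v) (longChild c)) ⟩
    occ (i ∷ v) (shortChild c) + occ (i ∷ v) (longChild c)
      ≡⟨ occ-++ (i ∷ v) (shortChild c) _ ⟨
    occ (i ∷ v) (shortChild c ++ longChild c)
      ≡⟨ occ-children i v c ⟩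
    occ v c
      ∎
    where
    open ≡-Reasoning
    w : Vertex (suc (suc n))
    w = o ∷ i ∷ v

module _ (x : Vertex n) (r : List (Vertex n)) where

  private
    c : List (Vertex n)
    c = x ∷ r
    t : Vertex n
    t = top c

  LL-oddChain : OddChain c → OddChain (LL c)
  LL-oddChain (chain , odd) =
    longChild-chain (longChild c) (longChild-chain c chain) , two-more (oddLength-map _ (oddLength-map _ odd))

  SL-oddChain : OddChain c → OddChain (SL c)
  SL-oddChain (chain , odd) =
    shortChild-chain (false ∷ x) (true ∷ x) (map (true ∷_) r) (longChild-chain c chain) ,
    oddLength-map _ (oddLength-map _ odd)

  top-LL : top (LL c) ≡ true ∷ true ∷ t
  top-LL = trans (top-longChild (false ∷ x) (map (true ∷_) c)) (cong (true ∷_) (top-longChild x r))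

  top-SL : top (SL c) ≡ false ∷ true ∷ t
  top-SL = trans (top-map false (true ∷ x) (map (true ∷_) r)) (cong (false ∷_) (top-longChild x r))

module _ (x y z : Vertex n) (r : List (Vertex n)) where

  private
    c : List (Vertex n)
    c = x ∷ y ∷ z ∷ r
    t : Vertex n
    t = top c

  LS-oddChain : OddChain c → OddChain (LS c)
  LS-oddChain (chain , two-more odd) =
    longChild-chain (shortChild c) (shortChild-chain x y (z ∷ r) chain) ,
    two-more (oddLength-map _ (oddLength-map _ odd))

  SS-oddChain : OddChain c → OddChain (SS c)
  SS-oddChain (chain , two-more odd) =
    shortChild-chain (false ∷ y) (false ∷ z) (map (false ∷_) r) (shortChild-chain x y (z ∷ r) chain) ,
    oddLength-map _ (oddLength-map _ odd)

  top-LS : top (LS c) ≡ true ∷ false ∷ t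
  top-LS = trans (top-longChild (false ∷ y) (map (false ∷_) (z ∷ r)))
                 (cong (true ∷_) (top-shortChild x y (z ∷ r)))

  top-SS : top (SS c) ≡ false ∷ false ∷ t
  top-SS = trans (top-shortChild (false ∷ y) (false ∷ z) (map (false ∷_) r))
                 (cong (false ∷_) (top-shortChild x y (z ∷ r)))

-- The grandchildren of c, ordered so that their tops run 01t 00t 10t 11t (rising) or
-- 11t 10t 00t 01t (falling) where t is the top of c; a one-vertex chain has only SL and LL.
rising falling : List (Vertex n) → List (ChainPair (suc (suc n)))
rising c@(_ ∷ [])        = (SL c , LL c) ∷ []
rising c@(_ ∷ _ ∷ _ ∷ _) = (SL c , SS c) ∷ (LS c , LL c) ∷ []
rising _                 = []
falling c@(_ ∷ [])        = (LL c , SL c) ∷ []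
falling c@(_ ∷ _ ∷ _ ∷ _) = (LL c , LS c) ∷ (SS c , SL c) ∷ []
falling _                 = []

rising-oddChains : (c : List (Vertex n)) → OddChain c → All OddChain (components (rising c))
rising-oddChains (x ∷ [])        oc = SL-oddChain x [] oc ∷ LL-oddChain x [] oc ∷ []
rising-oddChains (x ∷ y ∷ [])    (_ , two-more ())
rising-oddChains (x ∷ y ∷ z ∷ r) oc =
  SL-oddChain x (y ∷ z ∷ r) oc ∷ SS-oddChain x y z r oc ∷
  LS-oddChain x y z r oc ∷ LL-oddChain x (y ∷ z ∷ r) oc ∷ []

falling-oddChains : (c : List (Vertex n)) → OddChain c → All OddChain (components (falling c))
falling-oddChains (x ∷ [])        oc = LL-oddChain x [] oc ∷ SL-oddChain x [] oc ∷ []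
falling-oddChains (x ∷ y ∷ [])    (_ , two-more ())
falling-oddChains (x ∷ y ∷ z ∷ r) oc =
  LL-oddChain x (y ∷ z ∷ r) oc ∷ LS-oddChain x y z r oc ∷
  SS-oddChain x y z r oc ∷ SL-oddChain x (y ∷ z ∷ r) oc ∷ []

occ-rising : ∀ o i (v : Vertex n) c → OddLength c → occ (o ∷ i ∷ v) (vertices (rising c)) ≡ occ v c
occ-rising {n} o i v c@(x ∷ []) one = begin
  occ w (vertices (rising c))        ≡⟨ occ-concat w (components (rising c)) ⟩
  occ w (SL c) + (occ w (LL c) + 0)  ≡⟨ cong (occ w (SL c) +_) (+-identityʳ _) ⟩
  occ w (SL c) + occ w (LL c)        ≡⟨ occ-grandchildren c o i v ⟩
  occ v c                            ∎
  where
  open ≡-Reasoning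
  w : Vertex (suc (suc n))
  w = o ∷ i ∷ v
occ-rising o i v (x ∷ y ∷ []) (two-more ())
occ-rising {n} o i v c@(x ∷ y ∷ z ∷ r) _ = begin
  occ w (vertices (rising c))
    ≡⟨ occ-concat w (components (rising c)) ⟩
  occ w (SL c) + (occ w (SS c) + (occ w (LS c) + (occ w (LL c) + 0)))
    ≡⟨ rearrange (occ w (SL c)) (occ w (SS c)) (occ w (LS c)) (occ w (LL c)) ⟩
  occ w (SS c) + occ w (LS c) + (occ w (SL c) + occ w (LL c))
    ≡⟨ occ-grandchildren c o i v ⟩
  occ v c
    ∎
  where
  open ≡-Reasoning
  w : Vertex (suc (suc n))
  w = o ∷ i ∷ v
  rearrange : ∀ a b c d → a + (b + (c + (d + 0))) ≡ b + c + (a + d)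
  rearrange = solve-∀

occ-falling : ∀ o i (v : Vertex n) c → OddLength c → occ (o ∷ i ∷ v) (vertices (falling c)) ≡ occ v c
occ-falling {n} o i v c@(x ∷ []) one = begin
  occ w (vertices (falling c))       ≡⟨ occ-concat w (components (falling c)) ⟩
  occ w (LL c) + (occ w (SL c) + 0)  ≡⟨ trans (cong (occ w (LL c) +_) (+-identityʳ _)) (+-comm (occ w (LL c)) _) ⟩
  occ w (SL c) + occ w (LL c)        ≡⟨ occ-grandchildren c o i v ⟩
  occ v c                            ∎
  where
  open ≡-Reasoning
  w : Vertex (suc (suc n))
  w = o ∷ i ∷ v
occ-falling o i v (x ∷ y ∷ []) (two-more ())
occ-falling {n} o i v c@(x ∷ y ∷ z ∷ r) _ = begin
  occ w (vertices (falling c))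
    ≡⟨ occ-concat w (components (falling c)) ⟩
  occ w (LL c) + (occ w (LS c) + (occ w (SS c) + (occ w (SL c) + 0)))
    ≡⟨ rearrange (occ w (LL c)) (occ w (LS c)) (occ w (SS c)) (occ w (SL c)) ⟩
  occ w (SS c) + occ w (LS c) + (occ w (SL c) + occ w (LL c))
    ≡⟨ occ-grandchildren c o i v ⟩
  occ v c
    ∎
  where
  open ≡-Reasoning
  w : Vertex (suc (suc n))
  w = o ∷ i ∷ v
  rearrange : ∀ a b c d → a + (b + (c + (d + 0))) ≡ c + b + (d + a)
  rearrange = solve-∀


rising-walk : ∀ {a} (c : List (Vertex n)) → OddLength c → Adjacent a (top c) →
              Walk Adjacent (false ∷ true ∷ a) (true ∷ true ∷ top c) ((false ∷ true ∷ a) ∷ tops (rising c))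
rising-walk {a = a} (x ∷ []) one a~t =
  move (∷-Adjacent false (true ∷ a) (true ∷ x) (∷-Adjacent true a x a~t))
    (move (flip-Adjacent false (true ∷ x)) (stay _))
rising-walk (x ∷ y ∷ []) (two-more ())
rising-walk {n} {a} c@(x ∷ y ∷ z ∷ r) _ a~t =
  subst (λ l → Walk Adjacent (false ∷ true ∷ a) (true ∷ true ∷ t) ((false ∷ true ∷ a) ∷ l)) (sym tops≡)
    (move (∷-Adjacent false (true ∷ a) (true ∷ t) (∷-Adjacent true a t a~t))
      (move (∷-Adjacent false (true ∷ t) (false ∷ t) (flip-Adjacent true t))
        (move (flip-Adjacent false (false ∷ t))
          (move (∷-Adjacent true (false ∷ t) (true ∷ t) (flip-Adjacent false t))
            (stay _)))))
  where
  t : Vertex n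
  t = top c
  tops≡ : tops (rising c) ≡
          (false ∷ true ∷ t) ∷ (false ∷ false ∷ t) ∷ (true ∷ false ∷ t) ∷ (true ∷ true ∷ t) ∷ []
  tops≡ = cong₂ _∷_ (top-SL x (y ∷ z ∷ r)) (cong₂ _∷_ (top-SS x y z r)
            (cong₂ _∷_ (top-LS x y z r) (cong₂ _∷_ (top-LL x (y ∷ z ∷ r)) refl)))

falling-walk : ∀ {s} (d : List (Vertex n)) → OddLength d → Adjacent s (top d) →
               Walk Adjacent (true ∷ true ∷ s) (false ∷ true ∷ top d) ((true ∷ true ∷ s) ∷ tops (falling d))
falling-walk {s = s} (x ∷ []) one s~t =
  move (∷-Adjacent true (true ∷ s) (true ∷ x) (∷-Adjacent true s x s~t))
    (move (flip-Adjacent true (true ∷ x)) (stay _))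
falling-walk (x ∷ y ∷ []) (two-more ())
falling-walk {n} {s} d@(x ∷ y ∷ z ∷ r) _ s~t =
  subst (λ l → Walk Adjacent (true ∷ true ∷ s) (false ∷ true ∷ t) ((true ∷ true ∷ s) ∷ l)) (sym tops≡)
    (move (∷-Adjacent true (true ∷ s) (true ∷ t) (∷-Adjacent true s t s~t))
      (move (∷-Adjacent true (true ∷ t) (false ∷ t) (flip-Adjacent true t))
        (move (flip-Adjacent true (false ∷ t))
          (move (∷-Adjacent false (false ∷ t) (true ∷ t) (flip-Adjacent false t))
            (stay _)))))
  where
  t : Vertex n
  t = top d
  tops≡ : tops (falling d) ≡
          (true ∷ true ∷ t) ∷ (true ∷ false ∷ t) ∷ (false ∷ false ∷ t) ∷ (false ∷ true ∷ t) ∷ []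
  tops≡ = cong₂ _∷_ (top-LL x (y ∷ z ∷ r)) (cong₂ _∷_ (top-LS x y z r)
            (cong₂ _∷_ (top-SS x y z r) (cong₂ _∷_ (top-SL x (y ∷ z ∷ r)) refl)))

components-++ : (ps qs : List (ChainPair n)) → components (ps ++ qs) ≡ components ps ++ components qs
components-++ []             qs = refl
components-++ ((c , d) ∷ ps) qs = cong (λ l → c ∷ d ∷ l) (components-++ ps qs)

tops-++ : (ps qs : List (ChainPair n)) → tops (ps ++ qs) ≡ tops ps ++ tops qs
tops-++ ps qs = trans (cong (map top) (components-++ ps qs)) (map-++ top (components ps) _)

occ-vertices-++ : ∀ (v : Vertex n) ps qs → occ v (vertices (ps ++ qs)) ≡ occ v (vertices ps) + occ v (vertices qs)
occ-vertices-++ v ps qs =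
  trans (cong (occ v ∘ concat) (components-++ ps qs))
        (trans (cong (occ v) (sym (concat-++ (components ps) _))) (occ-++ v (vertices ps) (vertices qs)))

nextPairs : List (ChainPair n) → List (ChainPair (suc (suc n)))
nextPairs []             = []
nextPairs ((c , d) ∷ ps) = rising c ++ falling d ++ nextPairs ps

nextPairs-oddChains : ∀ (ps : List (ChainPair n)) → All OddChain (components ps) →
                      All OddChain (components (nextPairs ps))
nextPairs-oddChains []             _                = []
nextPairs-oddChains ((c , d) ∷ ps) (oc ∷ od ∷ ocs) =
  subst (All OddChain)
        (sym (trans (components-++ (rising c) _) (cong (components (rising c) ++_) (components-++ (falling d) _))))
    (All.++⁺ (rising-oddChains c oc) (All.++⁺ (falling-oddChains d od) (nextPairs-oddChains ps ocs)))

occ-nextPairs : ∀ o i (v : Vertex n) ps → All OddChain (components ps) →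
                occ (o ∷ i ∷ v) (vertices (nextPairs ps)) ≡ occ v (vertices ps)
occ-nextPairs o i v []             _                              = refl
occ-nextPairs {n} o i v ((c , d) ∷ ps) ((_ , odd-c) ∷ (_ , odd-d) ∷ ocs) = begin
  occ w (vertices (rising c ++ falling d ++ nextPairs ps))
    ≡⟨ trans (occ-vertices-++ w (rising c) _) (cong (occ w (vertices (rising c)) +_) (occ-vertices-++ w (falling d) _)) ⟩
  occ w (vertices (rising c)) + (occ w (vertices (falling d)) + occ w (vertices (nextPairs ps)))
    ≡⟨ cong₂ _+_ (occ-rising o i v c odd-c) (cong₂ _+_ (occ-falling o i v d odd-d) (occ-nextPairs o i v ps ocs)) ⟩
  occ v c + (occ v d + occ v (vertices ps))
    ≡⟨ occ-vertices-∷ v c d ps ⟨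
  occ v (vertices ((c , d) ∷ ps))
    ∎
  where
  open ≡-Reasoning
  w : Vertex (suc (suc n))
  w = o ∷ i ∷ v

nextPairs-walk : ∀ (ps : List (ChainPair n)) {a z} → All OddChain (components ps) → Walk Adjacent a z (a ∷ tops ps) →
                 Walk Adjacent (false ∷ true ∷ a) (false ∷ true ∷ z) ((false ∷ true ∷ a) ∷ tops (nextPairs ps))
nextPairs-walk []             _                              (stay _)                = stay _
nextPairs-walk ((c , d) ∷ ps) ((_ , odd-c) ∷ (_ , odd-d) ∷ ocs) (move a~c (move c~d w)) =
  subst (λ l → Walk Adjacent _ _ (_ ∷ l)) (sym tops≡)
    (walk-join (rising-walk c odd-c a~c) (walk-join (falling-walk d odd-d c~d) (nextPairs-walk ps ocs w)))
  where
  tops≡ : tops (rising c ++ falling d ++ nextPairs ps) ≡ tops (rising c) ++ tops (falling d) ++ tops (nextPairs ps)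
  tops≡ = trans (tops-++ (rising c) _) (cong (tops (rising c) ++_) (tops-++ (falling d) _))

nextTopCycle : TopCycle n → TopCycle (suc (suc n))
nextTopCycle T = record
  { pairs      = nextPairs pairs
  ; odd-chains = nextPairs-oddChains pairs odd-chains
  ; enumerates = λ { (o ∷ i ∷ v) → trans (occ-nextPairs o i v pairs odd-chains) (enumerates v) }
  ; base       = false ∷ true ∷ base
  ; closed     = nextPairs-walk pairs odd-chains closed
  }
  where open TopCycle T

topCycle₂ : TopCycle 2
topCycle₂ = record
  { pairs      = (c , d) ∷ []
  ; odd-chains = ((refl , refl , refl , refl) , two-more one) ∷ ((refl , refl) , one) ∷ []
  ; enumerates = λ { (false ∷ false ∷ []) → refl ; (false ∷ true ∷ []) → refl
                   ; (true ∷ false ∷ [])  → refl ; (true ∷ true ∷ [])  → refl }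
  ; base       = false ∷ true ∷ []
  ; closed     = move refl (move refl (stay _))
  }
  where
  c d : List (Vertex 2)
  c = (false ∷ false ∷ []) ∷ (true ∷ false ∷ []) ∷ (true ∷ true ∷ []) ∷ []
  d = (false ∷ true ∷ []) ∷ []

tour₂ : GKTour 2
tour₂ = record
  { tour       = (false ∷ false ∷ []) ∷ (true ∷ false ∷ []) ∷ (true ∷ true ∷ [])
                 ∷ (false ∷ true ∷ []) ∷ []
  ; enumerates = λ { (false ∷ false ∷ []) → refl ; (false ∷ true ∷ []) → refl
                   ; (true ∷ false ∷ [])  → refl ; (true ∷ true ∷ [])  → refl }
  ; base       = false ∷ true ∷ []
  ; closed     = move refl (move refl (move refl (move refl (stay _))))
  ; covers     = λ { (false ∷ false ∷ []) _ refl → inj₁ now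
                   ; (true ∷ false ∷ [])  _ refl → inj₁ (later now)
                   ; (false ∷ true ∷ [])  _ ()
                   ; (true ∷ true ∷ [])   _ () }
  }

data Even : ℕ → Set where
  even-2  : Even 2
  even-+2 : Even n → Even (suc (suc n))

topCycle : Even n → TopCycle n
topCycle even-2      = topCycle₂
topCycle (even-+2 e) = nextTopCycle (topCycle e)

even-or-odd : ∀ m → Even (2 + m) ⊎ Even (1 + m)
even-or-odd zero          = inj₁ even-2
even-or-odd (suc zero)    = inj₂ even-2
even-or-odd (suc (suc m)) = Sum.map even-+2 even-+2 (even-or-odd m)

gkTour : ∀ m → GKTour (2 + m)
gkTour m with even-or-odd m
... | inj₁ even-2      = tour₂
... | inj₁ (even-+2 e) = gridTour (topCycle e)
... | inj₂ e           = zigzagTour (topCycle e)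

-- Reading a tour as a Hamilton cycle

data LastOrInject₁ : ∀ {m} → Fin (suc m) → Set where
  last   : ∀ {m} → LastOrInject₁ (fromℕ m)
  inject : ∀ {m} (j : Fin m) → LastOrInject₁ (inject₁ j)

lastOrInject₁ : ∀ {m} (i : Fin (suc m)) → LastOrInject₁ i
lastOrInject₁ {zero}  fzero    = last
lastOrInject₁ {suc m} fzero    = inject fzero
lastOrInject₁ {suc m} (fsuc i) with lastOrInject₁ i
... | last     = last
... | inject j = inject (fsuc j)

csuc-inject₁ : ∀ {m} (j : Fin m) → csuc (inject₁ j) ≡ fsuc j
csuc-inject₁ j = toℕ-injective (trans (toℕ-fromℕ< _)
  (trans (m<n⇒m%n≡m (s≤s (inject₁ℕ< j))) (cong suc (toℕ-inject₁ j))))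

csuc-fromℕ : ∀ m → csuc (fromℕ m) ≡ fzero
csuc-fromℕ m = toℕ-injective (trans (toℕ-fromℕ< _)
  (trans (cong (λ k → suc k % suc m) (toℕ-fromℕ m)) (n%n≡0 (suc m))))

module _ {A : Set} {R : Rel A 0ℓ} where

  walk-lookup-step : ∀ {b x xs} → Walk R x b (x ∷ xs) → (j : Fin (length xs)) →
                     R (lookup (x ∷ xs) (inject₁ j)) (lookup (x ∷ xs) (fsuc j))
  walk-lookup-step (move r _) fzero    = r
  walk-lookup-step (move _ w) (fsuc j) = walk-lookup-step w j

  walk-lookup-last : ∀ {b x xs} → Walk R x b (x ∷ xs) → lookup (x ∷ xs) (fromℕ (length xs)) ≡ b
  walk-lookup-last (stay _)   = refl
  walk-lookup-last (move _ w) = walk-lookup-last w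

  closed-walk-cyclic : ∀ {z x xs} → Walk R z z (z ∷ x ∷ xs) →
                       ∀ i → R (lookup (x ∷ xs) i) (lookup (x ∷ xs) (csuc i))
  closed-walk-cyclic {xs = xs} (move r w) i with lastOrInject₁ i
  ... | last     rewrite csuc-fromℕ (length xs) | walk-lookup-last w = r
  ... | inject j rewrite csuc-inject₁ j = walk-lookup-step w j

consecutive-index : ∀ {A : Set} {x y h : A} {t} → Consecutive x y (h ∷ t) →
                    ∃ λ (j : Fin (length t)) → lookup (h ∷ t) (inject₁ j) ≡ x × lookup (h ∷ t) (fsuc j) ≡ y
consecutive-index now                   = fzero , refl , refl
consecutive-index {t = _ ∷ _} (later c) = let j , p , q = consecutive-index c in fsuc j , p , q

cyclicOrder : ∀ {m} (H : List (Vertex n)) → length H ≡ m → Enumerates H → ∀ {z} → Walk Adjacent z z (z ∷ H) →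
              Σ (Fin m → Vertex n) λ f → Bijective _≡_ _≡_ f × (∀ i → Adjacent (f i) (f (csuc i))) ×
                                          (∀ {x y} → Consecutive x y H → ∃ λ i → f i ≡ x × f (csuc i) ≡ y)
cyclicOrder []          _    once _ = contradiction (once (replicate _ false)) λ ()
cyclicOrder H@(_ ∷ _)   refl once w =
  lookup H ,
  (lookup-injective H (λ v → ≤-reflexive (once v)) _ _ ,
   strictlySurjective⇒surjective (λ v → let v∈ = occ-∈ {xs = H} (once v) in index v∈ , sym (lookup-index v∈))) ,
  closed-walk-cyclic w ,
  λ c → let j , p , q = consecutive-index c in inject₁ j , p , trans (cong (lookup H) (csuc-inject₁ j)) q

hamiltonCycle : GKTour n → Σ (HamiltonCycle n) λ C → ∀ (x y : Vertex n) → GKEdge x y → CycleEdge C x y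
hamiltonCycle {n} record { tour = H ; enumerates = once ; closed = w ; covers = covers }
  with cyclicOrder H (length-enumeration n H once) once w
... | f , bijective , adjacent , index-of =
  record { vertex = f ; bijective = bijective ; adjacent = adjacent } ,
  λ x y up → edge (covers x y up)
  where
  edge : ∀ {x y} → Joined x y H → ∃ λ i → (f i ≡ x × f (csuc i) ≡ y) ⊎ (f i ≡ y × f (csuc i) ≡ x)
  edge (inj₁ c) = let i , p = index-of c in i , inj₁ p
  edge (inj₂ c) = let i , p = index-of c in i , inj₂ p

theorem3 : (n : ℕ) → n ≥ 2 →
    Σ (HamiltonCycle n) λ C → ∀ (x y : Vertex n) → GKEdge x y → CycleEdge C x y
theorem3 (suc (suc m)) (s≤s (s≤s z≤n)) = hamiltonCycle (gkTour m)
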